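{- Let $\langle H,T\rangle$ be an $\mathcal{X}_5$-interpretation and $F$ a nested expression. Then $\langle H,T\rangle\models F$ iff $H\models F^T$, and $\langle H,T\rangle\dashv F$ iff $H\dashv F^T$.
   Context: Fix a set of atoms $\mathit{At}$. An explicit literal is $p$ or $\sim p$; a set of explicit literals is consistent if it never contains both $p$ and $\sim p$. Nested expressions: $F ::= \top\mid\bot\mid p\mid F\vee F\mid F\wedge F\mid \neg F\mid \sim F$, regarded as formulas with $\neg F := F\to\bot$, $\top:=\neg\bot$. Classical satisfaction/falsification by a consistent set $X$: $X\models\top$, $X\not\dashv\top$; $X\not\models\bot$, $X\dashv\bot$; $X\models p$ iff $p\in X$, $X\dashv p$ iff $\sim p\in X$; $X\models F\wedge G$ iff both, $X\dashv F\wedge G$ iff one falsified; $X\models F\vee G$ iff one satisfied, $X\dashv F\vee G$ iff both falsified; $X\models\sim F$ iff $X\dashv F$, $X\dashv\sim F$ iff $X\models F$; $X\models\neg F$ iff $X\not\models F$, $X\dashv\neg F$ iff $X\models F$. Reduct: $p^T=p$, $\top^T=\top$, $\bot^T=\bot$, $(F\wedge G)^T=F^T\wedge G^T$, $(F\vee G)^T=F^T\vee G^T$, $(\sim F)^T=\sim(F^T)$, $(\neg F)^T=\bot$ if $T\models F$ and $\top$ otherwise. $\mathcal{X}_5$: an $\mathcal{X}_5$-interpretation is a pair $\langle H,T\rangle$ of consistent sets with $H\subseteq T$; $\langle H,T\rangle\not\models\bot$, $\langle H,T\rangle\dashv\bot$; $\models p$ iff $p\in H$, $\dashv p$ iff $\sim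 p\in H$; $\wedge,\vee,\sim$ as in the classical case; $\langle H,T\rangle\models\varphi\to\psi$ iff (i) $\langle H,T\rangle\not\models\varphi$ or $\langle H,T\rangle\models\psi$ and (ii) $\langle T,T\rangle\not\models\varphi$ or $\langle T,T\rangle\models\psi$; $\langle H,T\rangle\dashv\varphi\to\psi$ iff $\langle T,T\rangle\models\varphi$ and $\langle H,T\rangle\dashv\psi$. -}

module Defs where

open import Data.Bool using (Bool; true; false; not; _∧_; _∨_)
open import Relation.Binary.PropositionalEquality using (_≡_)
open import Data.Product using (_×_)
open import Data.Sum using (_⊎_)
open import Data.Empty using (⊥)
open import Data.Unit using (⊤)
open import Relation.Nullary using (¬_)

data Lit (At : Set) : Set where
  pos : At → Lit At
  neg : At → Lit At

LitSet : Set → Set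
LitSet At = Lit At → Bool

_∈_ : {At : Set} → Lit At → LitSet At → Set
l ∈ X = X l ≡ true

_⊆_ : {At : Set} → LitSet At → LitSet At → Set
H ⊆ T = ∀ l → l ∈ H → l ∈ T

Consistent : {At : Set} → LitSet At → Set
Consistent X = ∀ p → ¬ (pos p ∈ X × neg p ∈ X)

data Nested (At : Set) : Set where
  top bot : Nested At
  atom    : At → Nested At
  _∨ₙ_ _∧ₙ_ : Nested At → Nested At → Nested At
  ¬ₙ_     : Nested At → Nested At
  ∼ₙ_     : Nested At → Nested At

data Form (At : Set) : Set where
  ⊥f   : Form At
  atf  : At → Form At
  _∨f_ _∧f_ _⇒f_ : Form At → Form At → Form At
  ∼f_  : Form At → Form At

¬f_ : {At : Set} → Form At → Form At
¬f φ = φ ⇒f ⊥f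

⊤f : {At : Set} → Form At
⊤f = ¬f ⊥f

toForm : {At : Set} → Nested At → Form At
toForm top      = ⊤f
toForm bot      = ⊥f
toForm (atom p) = atf p
toForm (F ∨ₙ G) = toForm F ∨f toForm G
toForm (F ∧ₙ G) = toForm F ∧f toForm G
toForm (¬ₙ F)   = ¬f toForm F
toForm (∼ₙ F)   = ∼f toForm F

mutual
  sat : {At : Set} → LitSet At → Nested At → Bool
  sat X top      = true
  sat X bot      = false
  sat X (atom p) = X (pos p)
  sat X (F ∧ₙ G) = sat X F ∧ sat X G
  sat X (F ∨ₙ G) = sat X F ∨ sat X G
  sat X (∼ₙ F)   = fal X F
  sat X (¬ₙ F)   = not (sat X F)

  fal : {At : Set} → LitSet At → Nested At → Bool
  fal X top      = false
  fal X bot      = true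
  fal X (atom p) = X (neg p)
  fal X (F ∧ₙ G) = fal X F ∨ fal X G
  fal X (F ∨ₙ G) = fal X F ∧ fal X G
  fal X (∼ₙ F)   = sat X F
  fal X (¬ₙ F)   = sat X F

_⊨c_ : {At : Set} → LitSet At → Nested At → Set
X ⊨c F = sat X F ≡ true

_⊣c_ : {At : Set} → LitSet At → Nested At → Set
X ⊣c F = fal X F ≡ true

reduct : {At : Set} → Nested At → LitSet At → Nested At
reduct top      T = top
reduct bot      T = bot
reduct (atom p) T = atom p
reduct (F ∧ₙ G) T = reduct F T ∧ₙ reduct G T
reduct (F ∨ₙ G) T = reduct F T ∨ₙ reduct G T
reduct (∼ₙ F)   T = ∼ₙ reduct F T
reduct (¬ₙ F)   T with sat T F
... | true  = bot
... | false = top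

mutual
  _,_⊨₅_ : {At : Set} → LitSet At → LitSet At → Form At → Set
  H , T ⊨₅ ⊥f      = ⊥
  H , T ⊨₅ atf p   = pos p ∈ H
  H , T ⊨₅ (φ ∧f ψ) = (H , T ⊨₅ φ) × (H , T ⊨₅ ψ)
  H , T ⊨₅ (φ ∨f ψ) = (H , T ⊨₅ φ) ⊎ (H , T ⊨₅ ψ)
  H , T ⊨₅ (∼f φ)  = H , T ⊣₅ φ
  H , T ⊨₅ (φ ⇒f ψ) =
    ((¬ (H , T ⊨₅ φ)) ⊎ (H , T ⊨₅ ψ)) × ((¬ (T , T ⊨₅ φ)) ⊎ (T , T ⊨₅ ψ))

  _,_⊣₅_ : {At : Set} → LitSet At → LitSet At → Form At → Set
  H , T ⊣₅ ⊥f      = ⊤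
  H , T ⊣₅ atf p   = neg p ∈ H
  H , T ⊣₅ (φ ∧f ψ) = (H , T ⊣₅ φ) ⊎ (H , T ⊣₅ ψ)
  H , T ⊣₅ (φ ∨f ψ) = (H , T ⊣₅ φ) × (H , T ⊣₅ ψ)
  H , T ⊣₅ (∼f φ)  = H , T ⊨₅ φ
  H , T ⊣₅ (φ ⇒f ψ) = (T , T ⊨₅ φ) × (H , T ⊣₅ ψ)

X5Interp : {At : Set} → LitSet At → LitSet At → Set
X5Interp H T = Consistent H × Consistent T × H ⊆ T

module Submission where

-- The only real case is default
-- negation ¬F, whose reduct is ⊥ or ⊤ according to whether T ⊨ F.  Deciding
-- it needs two general facts established first:
--   * persistence: whatever ⟨H,T⟩ satisfies (falsifies), ⟨T,T⟩ does too;
--   * the reduct w.r.t. T does not change classical truth at T itself, so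
--     the induction hypothesis at ⟨T,T⟩ yields  ⟨T,T⟩ ⊨ F  iff  T ⊨ F.

open import Defs
open import Data.Bool using (true; false; _∧_; _∨_)
open import Data.Bool.Properties using (T-≡; T-∧; T-∨)
open import Data.Empty using (⊥-elim)
open import Data.Product using (_×_; _,_; proj₁; proj₂)
open import Data.Product.Function.NonDependent.Propositional using (_×-⇔_)
open import Data.Sum using (_⊎_; inj₁; inj₂)
open import Data.Sum.Function.Propositional using (_⊎-⇔_)
open import Data.Unit using (tt)
open import Function.Base using (id; _∘_)
open import Function.Bundles using (_⇔_; mk⇔; Equivalence)
open import Function.Properties.Equivalence using () renaming (sym to ⇔-sym; trans to ⇔-trans)
open import Relation.Binary.PropositionalEquality using (_≡_; refl; sym; trans; cong₂)
open import Relation.Nullary using (¬_)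

open Equivalence using (to; from)

∧-true : ∀ {a b} → (a ∧ b ≡ true) ⇔ ((a ≡ true) × (b ≡ true))
∧-true = ⇔-trans (⇔-sym T-≡) (⇔-trans T-∧ (T-≡ ×-⇔ T-≡))

∨-true : ∀ {a b} → (a ∨ b ≡ true) ⇔ ((a ≡ true) ⊎ (b ≡ true))
∨-true = ⇔-trans (⇔-sym T-≡) (⇔-trans T-∨ (T-≡ ⊎-⇔ T-≡))

⊆-refl : {At : Set} (T : LitSet At) → T ⊆ T
⊆-refl T l = id

persistence : {At : Set} {H T : LitSet At} → H ⊆ T → (φ : Form At) →
  (H , T ⊨₅ φ → T , T ⊨₅ φ) × (H , T ⊣₅ φ → T , T ⊣₅ φ)
persistence H⊆T ⊥f = (λ ()) , id
persistence H⊆T (atf p) = H⊆T (pos p) , H⊆T (neg p)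
persistence H⊆T (φ ∨f ψ) with persistence H⊆T φ | persistence H⊆T ψ
... | ⊨φ , ⊣φ | ⊨ψ , ⊣ψ =
  (λ { (inj₁ a) → inj₁ (⊨φ a) ; (inj₂ b) → inj₂ (⊨ψ b) }) ,
  (λ { (a , b) → ⊣φ a , ⊣ψ b })
persistence H⊆T (φ ∧f ψ) with persistence H⊆T φ | persistence H⊆T ψ
... | ⊨φ , ⊣φ | ⊨ψ , ⊣ψ =
  (λ { (a , b) → ⊨φ a , ⊨ψ b }) ,
  (λ { (inj₁ a) → inj₁ (⊣φ a) ; (inj₂ b) → inj₂ (⊣ψ b) })
-- an implication already carries its ⟨T,T⟩-condition as second component
persistence H⊆T (φ ⇒f ψ) =
  (λ { (_ , atT) → atT , atT }) ,
  (λ { (φ-atT , ⊣ψ) → φ-atT , proj₂ (persistence H⊆T ψ) ⊣ψ })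
persistence H⊆T (∼f φ) = proj₂ (persistence H⊆T φ) , proj₁ (persistence H⊆T φ)

reduct-at-self : {At : Set} (T : LitSet At) (F : Nested At) →
  (sat T (reduct F T) ≡ sat T F) × (fal T (reduct F T) ≡ fal T F)
reduct-at-self T top = refl , refl
reduct-at-self T bot = refl , refl
reduct-at-self T (atom p) = refl , refl
reduct-at-self T (F ∨ₙ G) with reduct-at-self T F | reduct-at-self T G
... | satF , falF | satG , falG = cong₂ _∨_ satF satG , cong₂ _∧_ falF falG
reduct-at-self T (F ∧ₙ G) with reduct-at-self T F | reduct-at-self T G
... | satF , falF | satG , falG = cong₂ _∧_ satF satG , cong₂ _∨_ falF falG
reduct-at-self T (¬ₙ F) with sat T F
... | true  = refl , refl
... | false = refl , refl
reduct-at-self T (∼ₙ F) = proj₂ (reduct-at-self T F) , proj₁ (reduct-at-self T F)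

Agrees : {At : Set} → LitSet At → LitSet At → Nested At → Set
Agrees H T F = ((H , T ⊨₅ toForm F) ⇔ (H ⊨c reduct F T)) ×
               ((H , T ⊣₅ toForm F) ⇔ (H ⊣c reduct F T))

-- Given that ⟨T,T⟩ ⊨ F exactly when T ⊨ F,
-- and that ⟨H,T⟩ ⊨ F implies ⟨T,T⟩ ⊨ F, both sides of Lemma 2 for ¬F are
-- decided by the truth value of F at T.
agrees-¬ : {At : Set} {H T : LitSet At} (F : Nested At) →
  (T , T ⊨₅ toForm F) ⇔ (T ⊨c F) →
  (H , T ⊨₅ toForm F → T , T ⊨₅ toForm F) →
  Agrees H T (¬ₙ F)
agrees-¬ {T = T} F atT persist with sat T F
... | true =
  mk⇔ (λ { (_ , inj₁ ¬F-atT) → ⊥-elim (¬F-atT (from atT refl)) ; (_ , inj₂ ()) }) (λ ()) ,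
  mk⇔ (λ _ → refl) (λ _ → from atT refl , tt)
... | false =
  mk⇔ (λ _ → refl) (λ _ → inj₁ (¬F-atT ∘ persist) , inj₁ ¬F-atT) ,
  mk⇔ (λ { (F-atT , _) → ⊥-elim (¬F-atT F-atT) }) (λ ())
  where
  ¬F-atT : ¬ (T , T ⊨₅ toForm F)
  ¬F-atT F-atT with to atT F-atT
  ... | ()

reduct-agrees : {At : Set} {H T : LitSet At} → H ⊆ T → (F : Nested At) → Agrees H T F
reduct-agrees H⊆T top = mk⇔ (λ _ → refl) (λ _ → inj₁ (λ ()) , inj₁ (λ ())) ,
                        mk⇔ (λ { (() , _) }) (λ ())
reduct-agrees H⊆T bot = mk⇔ (λ ()) (λ ()) , mk⇔ (λ _ → refl) (λ _ → tt)
reduct-agrees H⊆T (atom p) = mk⇔ id id , mk⇔ id id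
reduct-agrees H⊆T (F ∨ₙ G) with reduct-agrees H⊆T F | reduct-agrees H⊆T G
... | ⊨F , ⊣F | ⊨G , ⊣G = ⇔-trans (⊨F ⊎-⇔ ⊨G) (⇔-sym ∨-true) ,
                          ⇔-trans (⊣F ×-⇔ ⊣G) (⇔-sym ∧-true)
reduct-agrees H⊆T (F ∧ₙ G) with reduct-agrees H⊆T F | reduct-agrees H⊆T G
... | ⊨F , ⊣F | ⊨G , ⊣G = ⇔-trans (⊨F ×-⇔ ⊨G) (⇔-sym ∧-true) ,
                          ⇔-trans (⊣F ⊎-⇔ ⊣G) (⇔-sym ∨-true)
reduct-agrees H⊆T (∼ₙ F) = proj₂ (reduct-agrees H⊆T F) , proj₁ (reduct-agrees H⊆T F)
reduct-agrees {T = T} H⊆T (¬ₙ F) =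
  agrees-¬ F F-atT (proj₁ (persistence H⊆T (toForm F)))
  where
  -- the induction hypothesis at ⟨T,T⟩, with the reduct removed
  F-atT : (T , T ⊨₅ toForm F) ⇔ (T ⊨c F)
  F-atT = ⇔-trans (proj₁ (reduct-agrees (⊆-refl T) F)) (mk⇔ (trans (sym same)) (trans same))
    where
    same : sat T (reduct F T) ≡ sat T F
    same = proj₁ (reduct-at-self T F)

lemma2 : {At : Set} (H T : LitSet At) → X5Interp H T → (F : Nested At) →
    ((H , T ⊨₅ toForm F) ⇔ (H ⊨c reduct F T)) ×
    ((H , T ⊣₅ toForm F) ⇔ (H ⊣c reduct F T))
lemma2 H T (_ , _ , H⊆T) F = reduct-agrees H⊆T F
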